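{- Let $\pi$ be a degree sequence and $G\in\Gamma(\pi)$. Suppose there exist three vertices $u,v,w$ of $G$ such that $uv\in E(G)$, $uw\notin E(G)$, $d(v)<d(w)\le d(u)$, and $d(u)>d(x)$ for every $x\in N(w)$. Then $G$ is not an extremal graph of $\Gamma(\pi)$.
   Context: Graphs are finite, simple and connected. $N(v)$ is the neighbor set and $d(v)$ the degree of $v$. For a non-increasing sequence $\pi=(d_1,\dots,d_n)$ of positive integers, $\Gamma(\pi)$ is the set of connected graphs with degree sequence $\pi$. For a symmetric function $f(x,y)$ on pairs of positive reals, $M_f(G)=\sum_{uv\in E(G)}f(d(u),d(v))$. $f$ is escalating if $f(x_1,x_2)+f(y_1,y_2)\ge f(x_2,y_1)+f(x_1,y_2)$ for all $x_1\ge y_1>0$, $x_2\ge y_2>0$, strictly whenever $x_1>y_1$ and $x_2>y_2$; de-escalating if the reverse inequality $\le$ holds for all such values, strictly ($<$) whenever $x_1>y_1$ and $x_2>y_2$. A fixed function $f$ that is escalating or de-escalating is given; a graph $G$ in a class $\mathcal G$ is called an extremal graph of $\mathcal G$ if either $f$ is escalating and $M_f(G)$ is the maximum of $M_f$ over $\mathcal G$, or $f$ is de-escalating and $M_f(G)$ is the minimum of $M_f$ over $\mathcal G$. -}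

module Defs where

open import Level using (0ℓ)
open import Data.Bool using (Bool; true; false; if_then_else_; _∧_)
open import Data.Nat using (ℕ; zero; suc; _<ᵇ_) renaming (_+_ to _+ℕ_; _≤_ to _≤ℕ_; _<_ to _<ℕ_)
open import Data.Fin using (Fin; toℕ)
open import Data.List using (List; []; _∷_; map; concatMap; foldr)
open import Data.Nat.ListAction using (sum)
open import Data.List.Relation.Binary.Permutation.Propositional using (_↭_)
open import Data.List.Relation.Unary.Linked using (Linked)
open import Data.List.Relation.Unary.All using (All)
open import Data.Fin using () renaming (_≟_ to _≟F_)
open import Data.List using (allFin)
open import Data.Product using (_×_)
open import Data.Sum using (_⊎_)
open import Relation.Binary.PropositionalEquality using (_≡_; _≢_)

-- Codomain of f: a totally ordered abelian group (ℝ is an instance).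

record OrderedAbGroup : Set₁ where
  infixl 6 _+_
  infix 4 _≤_
  field
    Carrier : Set
    0#      : Carrier
    _+_     : Carrier → Carrier → Carrier
    -_      : Carrier → Carrier
    _≤_     : Carrier → Carrier → Set
    +-assoc     : ∀ x y z → (x + y) + z ≡ x + (y + z)
    +-comm      : ∀ x y → x + y ≡ y + x
    +-identityˡ : ∀ x → 0# + x ≡ x
    +-inverseˡ  : ∀ x → (- x) + x ≡ 0#
    ≤-refl      : ∀ {x} → x ≤ x
    ≤-trans     : ∀ {x y z} → x ≤ y → y ≤ z → x ≤ z
    ≤-antisym   : ∀ {x y} → x ≤ y → y ≤ x → x ≡ y
    ≤-total     : ∀ x y → x ≤ y ⊎ y ≤ x
    +-monoˡ-≤   : ∀ {x y} z → x ≤ y → x + z ≤ y + z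

  infix 4 _<_
  _<_ : Carrier → Carrier → Set
  x < y = x ≤ y × x ≢ y

  sumC : List Carrier → Carrier
  sumC = foldr _+_ 0#

record Graph (n : ℕ) : Set where
  field
    adj     : Fin n → Fin n → Bool
    adj-sym : ∀ u v → adj u v ≡ adj v u
    irrefl  : ∀ v → adj v v ≡ false
open Graph public

data Reach {n : ℕ} (G : Graph n) : Fin n → Fin n → Set where
  here : ∀ {u} → Reach G u u
  step : ∀ {u w v} → adj G u w ≡ true → Reach G w v → Reach G u v

Connected : ∀ {n} → Graph n → Set
Connected {n} G = ∀ (u v : Fin n) → Reach G u v

deg : ∀ {n} → Graph n → Fin n → ℕ
deg {n} G v = sum (map (λ x → if adj G v x then 1 else 0) (allFin n))

degList : ∀ {n} → Graph n → List ℕ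
degList {n} G = map (deg G) (allFin n)

NonIncreasing : List ℕ → Set
NonIncreasing π = Linked (λ a b → b ≤ℕ a) π

InΓ : ∀ {n} → List ℕ → Graph n → Set
InΓ π G = Connected G × (degList G ↭ π)

edges : ∀ {n} → Graph n → List (Fin n × Fin n)
edges {n} G =
  concatMap (λ i → concatMap (λ j →
      if (toℕ i <ᵇ toℕ j) ∧ adj G i j then (i Data.Product., j) ∷ [] else [])
    (allFin n)) (allFin n)

module _ (R : OrderedAbGroup) where
  open OrderedAbGroup R

  Symmetric : (ℕ → ℕ → Carrier) → Set
  Symmetric f = ∀ x y → f x y ≡ f y x

  Escalating : (ℕ → ℕ → Carrier) → Set
  Escalating f =
    (∀ x₁ x₂ y₁ y₂ → 0 <ℕ y₁ → y₁ ≤ℕ x₁ → 0 <ℕ y₂ → y₂ ≤ℕ x₂ →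
       f x₂ y₁ + f x₁ y₂ ≤ f x₁ x₂ + f y₁ y₂)
    × (∀ x₁ x₂ y₁ y₂ → 0 <ℕ y₁ → y₁ <ℕ x₁ → 0 <ℕ y₂ → y₂ <ℕ x₂ →
       f x₂ y₁ + f x₁ y₂ < f x₁ x₂ + f y₁ y₂)

  DeEscalating : (ℕ → ℕ → Carrier) → Set
  DeEscalating f =
    (∀ x₁ x₂ y₁ y₂ → 0 <ℕ y₁ → y₁ ≤ℕ x₁ → 0 <ℕ y₂ → y₂ ≤ℕ x₂ →
       f x₁ x₂ + f y₁ y₂ ≤ f x₂ y₁ + f x₁ y₂)
    × (∀ x₁ x₂ y₁ y₂ → 0 <ℕ y₁ → y₁ <ℕ x₁ → 0 <ℕ y₂ → y₂ <ℕ x₂ →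
       f x₁ x₂ + f y₁ y₂ < f x₂ y₁ + f x₁ y₂)

  Mf : (ℕ → ℕ → Carrier) → ∀ {n} → Graph n → Carrier
  Mf f G = sumC (map (λ e → f (deg G (Data.Product.proj₁ e)) (deg G (Data.Product.proj₂ e))) (edges G))

  -- G is an extremal graph of Γ(π) (graphs in Γ(π) have n = length π vertices)
  Extremal : (ℕ → ℕ → Carrier) → List ℕ → ∀ {n} → Graph n → Set
  Extremal f π {n} G =
    InΓ π G ×
    ((Escalating f × (∀ (H : Graph n) → InΓ π H → Mf f H ≤ Mf f G))
     ⊎ (DeEscalating f × (∀ (H : Graph n) → InΓ π H → Mf f G ≤ Mf f H)))

module Submission where

-- Pick a neighbour x of w outside N(v) ∪ {v} and switch the edges uv, wx to uw, vx. Every degree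
-- is preserved, and M_f changes by f(d(u),d(w)) + f(d(v),d(x)) − f(d(u),d(v)) − f(d(w),d(x)),
-- which is positive for escalating and negative for de-escalating f since d(x) < d(u) and
-- d(v) < d(w). The switched graph stays connected as soon as u and v remain joined in it, and x
-- can be chosen so that they do: through u–w–v if w ~ v; otherwise take a walk in G − uv from v
-- or from u to w, let y be its last vertex before w, and use u–w–y⇝v with some x ≠ y,
-- respectively u⇝y–v with x = y.

open import Defs
open import Level using (0ℓ)
open import Algebra.Bundles using (AbelianGroup; CommutativeMonoid)
open import Data.Bool using (Bool; true; false; _∧_; _∨_; not; if_then_else_)
open import Data.Bool.Properties using (∧-comm; ∧-zeroʳ; ∧-identityʳ; ∨-zeroʳ; ∨-identityʳ; ∨-comm)
open import Data.Fin using (Fin; zero; suc; toℕ; _≟_)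
open import Data.Fin.Properties using (toℕ-injective)
open import Data.List using (List; []; _∷_; _++_; map; concatMap; allFin; tabulate)
open import Data.List.Properties using (map-tabulate; map-++; map-cong)
open import Data.List.Relation.Binary.Permutation.Propositional using (_↭_)
open import Data.Nat using (ℕ; zero; suc)
open import Data.Product using (Σ-syntax; ∃-syntax; _×_; _,_; proj₁; proj₂)
open import Data.Sum using (_⊎_; inj₁; inj₂)
import Data.Vec.Functional as Vector
open import Function using (id; _∘_; mk⇔)
open import Relation.Binary.PropositionalEquality as ≡
  using (_≡_; _≢_; refl; sym; trans; cong; cong₂; subst; subst₂; module ≡-Reasoning)
open import Relation.Nullary using (Dec; does; yes; no; ¬_; contradiction)
open import Relation.Nullary.Decidable using (_×-dec_; _⊎-dec_; dec-true; dec-false; does-⇔)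
import Data.Sum as Sum
import Data.Product as Product

private
  variable
    n : ℕ
    G H : Graph n

_==_ : Fin n → Fin n → Bool
i == j = does (i ≟ j)

==⇒≡ : {i j : Fin n} → i == j ≡ true → i ≡ j
==⇒≡ {i = i} {j} i==j with i ≟ j
... | yes i≡j = i≡j
... | no _    = contradiction i==j λ ()

IsPair : Fin n → Fin n → Fin n → Fin n → Set
IsPair a b i j = (i ≡ a × j ≡ b) ⊎ (i ≡ b × j ≡ a)

isPair? : (a b i j : Fin n) → Dec (IsPair a b i j)
isPair? a b i j = (i ≟ a ×-dec j ≟ b) ⊎-dec (i ≟ b ×-dec j ≟ a)

isPair : Fin n → Fin n → Fin n → Fin n → Bool
isPair a b i j = does (isPair? a b i j)

isPair-sym : (a b i j : Fin n) → isPair a b i j ≡ isPair a b j i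
isPair-sym a b i j = does-⇔ (mk⇔ flip flip) (isPair? a b i j) (isPair? a b j i)
  where
  flip : ∀ {i j} → IsPair a b i j → IsPair a b j i
  flip = Sum.swap ∘ Sum.map Product.swap Product.swap

isPair-refl : (a b : Fin n) → isPair a b a b ≡ true
isPair-refl a b = dec-true (isPair? a b a b) (inj₁ (refl , refl))

isPair-irrefl : {a b : Fin n} → a ≢ b → ∀ i → isPair a b i i ≡ false
isPair-irrefl a≢b i = dec-false (isPair? _ _ i i) λ
  { (inj₁ (refl , refl)) → a≢b refl
  ; (inj₂ (refl , refl)) → a≢b refl }

removeEdge : Graph n → Fin n → Fin n → Graph n
removeEdge G a b = record
  { adj     = λ i j → adj G i j ∧ not (isPair a b i j)
  ; adj-sym = λ i j → cong₂ (λ e p → e ∧ not p) (adj-sym G i j) (isPair-sym a b i j)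
  ; irrefl  = λ i → cong (λ e → e ∧ not (isPair a b i i)) (irrefl G i)
  }

addEdge : Graph n → (a b : Fin n) → a ≢ b → Graph n
addEdge G a b a≢b = record
  { adj     = λ i j → adj G i j ∨ isPair a b i j
  ; adj-sym = λ i j → cong₂ _∨_ (adj-sym G i j) (isPair-sym a b i j)
  ; irrefl  = λ i → cong₂ _∨_ (irrefl G i) (isPair-irrefl a≢b i)
  }

removeVertex : Graph n → Fin n → Graph n
removeVertex G t = record
  { adj     = λ i j → adj G i j ∧ not (i == t ∨ j == t)
  ; adj-sym = λ i j → cong₂ (λ e p → e ∧ not p) (adj-sym G i j) (∨-comm (i == t) (j == t))
  ; irrefl  = λ i → cong (λ e → e ∧ not (i == t ∨ i == t)) (irrefl G i)
  }

_⊆_ : Graph n → Graph n → Set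
G ⊆ H = ∀ {i j} → adj G i j ≡ true → adj H i j ≡ true

removeEdge-keeps : ∀ (G : Graph n) {a b i j} → adj G i j ≡ true → ¬ IsPair a b i j →
                   adj (removeEdge G a b) i j ≡ true
removeEdge-keeps G {a} {b} {i} {j} i~j ¬ab rewrite i~j | dec-false (isPair? a b i j) ¬ab = refl

removeEdge-⊆ : (G : Graph n) (a b : Fin n) → removeEdge G a b ⊆ G
removeEdge-⊆ G a b {i} {j} i~j with adj G i j
... | true = refl

removeVertex-keeps : ∀ (G : Graph n) {t i j} → adj G i j ≡ true → i ≢ t → j ≢ t →
                     adj (removeVertex G t) i j ≡ true
removeVertex-keeps G {t} {i} {j} i~j i≢t j≢t
  rewrite i~j | dec-false (i ≟ t) i≢t | dec-false (j ≟ t) j≢t = refl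

addEdge-⊆ : (G : Graph n) {a b : Fin n} (a≢b : a ≢ b) → G ⊆ addEdge G a b a≢b
addEdge-⊆ G a≢b i~j rewrite i~j = refl

addEdge-adds : (G : Graph n) {a b : Fin n} (a≢b : a ≢ b) → adj (addEdge G a b a≢b) a b ≡ true
addEdge-adds G {a} {b} a≢b rewrite isPair-refl a b = ∨-zeroʳ (adj G a b)

adj⇒≢ : ∀ (G : Graph n) {i j} → adj G i j ≡ true → i ≢ j
adj⇒≢ G {i} i~i refl = contradiction (trans (sym i~i) (irrefl G i)) λ ()

⊆-absent : G ⊆ H → ∀ {i j} → adj H i j ≡ false → adj G i j ≡ false
⊆-absent {G = G} G⊆H {i} {j} i≁j with adj G i j in i~j
... | true  = contradiction (trans (sym (G⊆H i~j)) i≁j) λ ()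
... | false = refl

addEdge-absent : ∀ (G : Graph n) {a b} (a≢b : a ≢ b) {i j} → adj G i j ≡ false → ¬ IsPair a b i j →
                 adj (addEdge G a b a≢b) i j ≡ false
addEdge-absent G {a} {b} _ {i} {j} i≁j ¬ab rewrite i≁j | dec-false (isPair? a b i j) ¬ab = refl

removeVertex-edge : ∀ (G : Graph n) {t i j} → adj (removeVertex G t) i j ≡ true →
                    adj G i j ≡ true × i ≢ t × j ≢ t
removeVertex-edge G {t} {i} {j} e with adj G i j | i ≟ t | j ≟ t
... | true  | no i≢t | no j≢t = refl , i≢t , j≢t
... | true  | no _   | yes _  = contradiction e λ ()
... | true  | yes _  | _      = contradiction e λ ()
... | false | _      | _      = contradiction e λ ()

record AddsEdge (G : Graph n) (a b : Fin n) (H : Graph n) : Set where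
  field
    absent : adj G a b ≡ false
    adj-∨  : ∀ i j → adj H i j ≡ adj G i j ∨ isPair a b i j

  distinct : a ≢ b
  distinct refl = contradiction (trans (sym (irrefl H a)) (trans (adj-∨ a a) eq)) λ ()
    where
    eq : adj G a a ∨ isPair a a a a ≡ true
    eq rewrite isPair-refl a a = ∨-zeroʳ (adj G a a)

  disjoint : ∀ i j → adj G i j ∧ isPair a b i j ≡ false
  disjoint i j with isPair? a b i j
  ... | no ¬ab rewrite dec-false (isPair? a b i j) ¬ab = ∧-zeroʳ (adj G i j)
  ... | yes (inj₁ (refl , refl)) = cong (_∧ isPair a b a b) absent
  ... | yes (inj₂ (refl , refl)) = cong (_∧ isPair a b b a) (trans (adj-sym G b a) absent)

addEdge-AddsEdge : (G : Graph n) {a b : Fin n} (a≢b : a ≢ b) → adj G a b ≡ false →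
                   AddsEdge G a b (addEdge G a b a≢b)
addEdge-AddsEdge G a≢b a≁b = record { absent = a≁b ; adj-∨ = λ _ _ → refl }

removeEdge-AddsEdge : (G : Graph n) {a b : Fin n} → adj G a b ≡ true →
                      AddsEdge (removeEdge G a b) a b G
removeEdge-AddsEdge G {a} {b} a~b = record { absent = absent ; adj-∨ = adj-∨ }
  where
  absent : adj G a b ∧ not (isPair a b a b) ≡ false
  absent rewrite isPair-refl a b = ∧-zeroʳ (adj G a b)
  adj-∨ : ∀ i j → adj G i j ≡ (adj G i j ∧ not (isPair a b i j)) ∨ isPair a b i j
  adj-∨ i j with isPair? a b i j
  ... | no ¬ab rewrite dec-false (isPair? a b i j) ¬ab = sym (trans (∨-identityʳ _) (∧-identityʳ _))
  ... | yes (inj₁ (refl , refl)) rewrite a~b | isPair-refl a b = refl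
  ... | yes (inj₂ (refl , refl)) rewrite adj-sym G b a | a~b | isPair-sym a b b a | isPair-refl a b = refl

edge : ∀ {a b} → adj G a b ≡ true → Reach G a b
edge a~b = step a~b here

Reach-++ : ∀ {a b c} → Reach G a b → Reach G b c → Reach G a c
Reach-++ here        q = q
Reach-++ (step e p) q = step e (Reach-++ p q)

Reach-sym : ∀ {a b} → Reach G a b → Reach G b a
Reach-sym here        = here
Reach-sym {G = G} (step e p) = Reach-++ (Reach-sym p) (edge (trans (adj-sym G _ _) e))

Reach-lift : (∀ {i j} → adj G i j ≡ true → Reach H i j) →
             ∀ {a b} → Reach G a b → Reach H a b
Reach-lift lift here        = here
Reach-lift lift (step e p) = Reach-++ (lift e) (Reach-lift lift p)

Reach-mono : G ⊆ H → ∀ {a b} → Reach G a b → Reach H a b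
Reach-mono G⊆H = Reach-lift (edge ∘ G⊆H)

first-arrival : ∀ {a t} → Reach G a t → a ≢ t →
                ∃[ y ] adj G y t ≡ true × Reach (removeVertex G t) a y
first-arrival here a≢t = contradiction refl a≢t
first-arrival {G = G} {a = a} {t = t} (step {w = c} a~c c⇝t) a≢t with c ≟ t
... | yes refl = a , a~c , here
... | no c≢t   =
  let y , y~t , c⇝y = first-arrival c⇝t c≢t
  in  y , y~t , step (removeVertex-keeps G a~c a≢t c≢t) c⇝y

removeEdge-reach : ∀ {a b z} → Reach G z a →
                   Reach (removeEdge G a b) z a ⊎ Reach (removeEdge G a b) z b
removeEdge-reach here = inj₁ here
removeEdge-reach {G = G} {a = a} {b = b} (step {u = z} {w = c} z~c c⇝a)
  with isPair? a b z c | removeEdge-reach c⇝a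
... | yes (inj₁ (refl , _)) | _        = inj₁ here
... | yes (inj₂ (refl , _)) | _        = inj₂ here
... | no ¬ab                | inj₁ c⇝a′ = inj₁ (step (removeEdge-keeps G z~c ¬ab) c⇝a′)
... | no ¬ab                | inj₂ c⇝b′ = inj₂ (step (removeEdge-keeps G z~c ¬ab) c⇝b′)

Connected-lift : (∀ {i j} → adj G i j ≡ true → Reach H i j) →
                 Connected G → Connected H
Connected-lift lift connG a b = Reach-lift lift (connG a b)

record Switchable (G : Graph n) (u v w x : Fin n) : Set where
  field
    u~v : adj G u v ≡ true
    w~x : adj G w x ≡ true
    u≁w : adj G u w ≡ false
    v≁x : adj G v x ≡ false
    u≢w : u ≢ w
    v≢w : v ≢ w
    v≢x : v ≢ x

module Switch {G : Graph n} {u v w x : Fin n} (s : Switchable G u v w x) where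

  open Switchable s

  u≢v : u ≢ v
  u≢v = adj⇒≢ G u~v

  G₁ G₂ G₃ graph : Graph n
  G₁    = removeEdge G u v
  G₂    = removeEdge G₁ w x
  G₃    = addEdge G₂ u w u≢w
  graph = addEdge G₃ v x v≢x

  G₁+uv : AddsEdge G₁ u v G
  G₁+uv = removeEdge-AddsEdge G u~v

  G₂+wx : AddsEdge G₂ w x G₁
  G₂+wx = removeEdge-AddsEdge G₁ (removeEdge-keeps G w~x λ
    { (inj₁ (w≡u , _)) → u≢w (sym w≡u)
    ; (inj₂ (w≡v , _)) → v≢w (sym w≡v) })

  G₂⊆G : G₂ ⊆ G
  G₂⊆G = removeEdge-⊆ G u v ∘ removeEdge-⊆ G₁ w x

  G₂+uw : AddsEdge G₂ u w G₃
  G₂+uw = addEdge-AddsEdge G₂ u≢w (⊆-absent {G = G₂} {H = G} G₂⊆G u≁w)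

  G₃+vx : AddsEdge G₃ v x graph
  G₃+vx = addEdge-AddsEdge G₃ v≢x (addEdge-absent G₂ u≢w (⊆-absent {G = G₂} {H = G} G₂⊆G v≁x) λ
    { (inj₁ (v≡u , _)) → u≢v (sym v≡u)
    ; (inj₂ (v≡w , _)) → v≢w v≡w })

  module _ {c ℓ} (M : CommutativeMonoid c ℓ) where
    open CommutativeMonoid M renaming (refl to ≈-refl; trans to ≈-trans)
    open import Algebra.Solver.CommutativeMonoid M using (solve; _⊕_; _⊜_)
    open import Relation.Binary.Reasoning.Setoid setoid

    balance : (μ : Graph n → Carrier) (δ : Fin n → Fin n → Carrier) →
              (∀ {H a b H′} → AddsEdge H a b H′ → μ H′ ≈ μ H ∙ δ a b) →
              μ graph ∙ (δ u v ∙ δ w x) ≈ μ G ∙ (δ u w ∙ δ v x)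
    balance μ δ μ-AddsEdge = begin
      μ graph ∙ (δ u v ∙ δ w x)
        ≈⟨ ∙-congʳ (≈-trans (μ-AddsEdge G₃+vx) (∙-congʳ (μ-AddsEdge G₂+uw))) ⟩
      (μ G₂ ∙ δ u w ∙ δ v x) ∙ (δ u v ∙ δ w x)
        ≈⟨ solve 5 (λ m p q r t → ((m ⊕ r) ⊕ t) ⊕ (p ⊕ q) ⊜ ((m ⊕ q) ⊕ p) ⊕ (r ⊕ t))
                   ≈-refl (μ G₂) (δ u v) (δ w x) (δ u w) (δ v x) ⟩
      (μ G₂ ∙ δ w x ∙ δ u v) ∙ (δ u w ∙ δ v x)
        ≈⟨ ∙-congʳ (≈-trans (μ-AddsEdge G₁+uv) (∙-congʳ (μ-AddsEdge G₂+wx))) ⟨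
      μ G ∙ (δ u w ∙ δ v x) ∎

  keeps : ∀ {i j} → adj G i j ≡ true → ¬ IsPair u v i j → ¬ IsPair w x i j → adj graph i j ≡ true
  keeps i~j ¬uv ¬wx =
    addEdge-⊆ G₃ v≢x (addEdge-⊆ G₂ u≢w (removeEdge-keeps G₁ (removeEdge-keeps G i~j ¬uv) ¬wx))

  u~w : adj graph u w ≡ true
  u~w = addEdge-⊆ G₃ v≢x (addEdge-adds G₂ u≢w)

  v~x : adj graph v x ≡ true
  v~x = addEdge-adds G₃ v≢x

  G₁-w⊆graph : removeVertex G₁ w ⊆ graph
  G₁-w⊆graph e with removeVertex-edge G₁ e
  ... | i~j , i≢w , j≢w = addEdge-⊆ G₃ v≢x (addEdge-⊆ G₂ u≢w (removeEdge-keeps G₁ i~j λ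
    { (inj₁ (i≡w , _)) → i≢w i≡w
    ; (inj₂ (_ , j≡w)) → j≢w j≡w }))

  connected : Reach graph u v → Connected G → Connected graph
  connected u⇝v = Connected-lift lift
    where
    w⇝x : Reach graph w x
    w⇝x = Reach-++ (Reach-sym (edge u~w)) (Reach-++ u⇝v (edge v~x))
    lift : ∀ {i j} → adj G i j ≡ true → Reach graph i j
    lift {i} {j} i~j with isPair? u v i j | isPair? w x i j
    ... | yes (inj₁ (refl , refl)) | _                        = u⇝v
    ... | yes (inj₂ (refl , refl)) | _                        = Reach-sym u⇝v
    ... | no _                     | yes (inj₁ (refl , refl)) = w⇝x
    ... | no _                     | yes (inj₂ (refl , refl)) = Reach-sym w⇝x
    ... | no ¬uv                   | no ¬wx                   = edge (keeps i~j ¬uv ¬wx)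

foldr-map-allFin : ∀ {a b} {A : Set a} {B : Set b} (_∙_ : A → B → B) (e : B) (g : Fin n → A) →
                   Data.List.foldr _∙_ e (map g (allFin n)) ≡ Vector.foldr _∙_ e g
foldr-map-allFin _∙_ e g = trans (cong (Data.List.foldr _∙_ e) (map-tabulate id g)) (foldr-tabulate g)
  where
  foldr-tabulate : ∀ {n} (h : Fin n → _) → Data.List.foldr _∙_ e (tabulate h) ≡ Vector.foldr _∙_ e h
  foldr-tabulate {zero}  h = refl
  foldr-tabulate {suc n} h = cong (h zero ∙_) (foldr-tabulate (h ∘ suc))

module FiniteSums {c ℓ} (M : CommutativeMonoid c ℓ) where

  open CommutativeMonoid M
    renaming (refl to ≈-refl; reflexive to ≈-reflexive; sym to ≈-sym; trans to ≈-trans)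
  open import Algebra.Properties.CommutativeMonoid.Sum M public
  open import Relation.Binary.Reasoning.Setoid setoid

  infixr 11 _⋆_
  _⋆_ : Bool → Carrier → Carrier
  b ⋆ x = if b then x else ε

  ⋆-cong : ∀ b {x y} → x ≈ y → b ⋆ x ≈ b ⋆ y
  ⋆-cong true  x≈y = x≈y
  ⋆-cong false _   = ≈-refl

  ⋆-∧ : ∀ b c x → (b ∧ c) ⋆ x ≡ b ⋆ c ⋆ x
  ⋆-∧ true  c x = ≡.refl
  ⋆-∧ false c x = ≡.refl

  ⋆-∨ : ∀ b c x → b ∧ c ≡ false → (b ∨ c) ⋆ x ≈ b ⋆ x ∙ c ⋆ x
  ⋆-∨ true  false x _ = ≈-sym (identityʳ x)
  ⋆-∨ false c     x _ = ≈-sym (identityˡ (c ⋆ x))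

  ∑-⋆ : ∀ {n} b (g : Fin n → Carrier) → ∑[ i < n ] b ⋆ g i ≈ b ⋆ sum g
  ∑-⋆     true  g = ≈-refl
  ∑-⋆ {n} false g = sum-replicate-zero n

  ∑-single : ∀ {n} (a : Fin n) (g : Fin n → Carrier) → ∑[ i < n ] (i == a) ⋆ g i ≈ g a
  ∑-single {suc n} zero g = begin
    g zero ∙ ∑[ i < n ] ε  ≈⟨ ∙-congˡ (sum-replicate-zero n) ⟩
    g zero ∙ ε             ≈⟨ identityʳ (g zero) ⟩
    g zero                  ∎
  ∑-single {suc n} (suc a) g = ≈-trans (identityˡ _) (∑-single a (g ∘ suc))

  ∑-∨ : ∀ {n} (β γ : Fin n → Bool) (g : Fin n → Carrier) → (∀ i → β i ∧ γ i ≡ false) →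
        ∑[ i < n ] (β i ∨ γ i) ⋆ g i ≈ ∑[ i < n ] β i ⋆ g i ∙ ∑[ i < n ] γ i ⋆ g i
  ∑-∨ β γ g disjoint = ≈-trans (sum-cong-≋ (λ i → ⋆-∨ (β i) (γ i) (g i) (disjoint i)))
                               (∑-distrib-+ (λ i → β i ⋆ g i) (λ i → γ i ⋆ g i))

  ∑-isPair : ∀ {n} {a b : Fin n} → a ≢ b → ∀ z (g : Fin n → Carrier) →
             ∑[ j < n ] isPair a b z j ⋆ g j ≈ (z == a) ⋆ g b ∙ (z == b) ⋆ g a
  ∑-isPair {n} {a} {b} a≢b z g = begin
    ∑[ j < n ] ((z == a ∧ j == b) ∨ (z == b ∧ j == a)) ⋆ g j
      ≈⟨ ∑-∨ _ _ g (λ j → ∧-disjoint (z == a) (j == b) (z == b) (j == a) z≠a∨z≠b) ⟩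
    ∑[ j < n ] (z == a ∧ j == b) ⋆ g j ∙ ∑[ j < n ] (z == b ∧ j == a) ⋆ g j
      ≡⟨ cong₂ _∙_ (sum-cong-≗ (λ j → ⋆-∧ (z == a) (j == b) (g j)))
                   (sum-cong-≗ (λ j → ⋆-∧ (z == b) (j == a) (g j))) ⟩
    ∑[ j < n ] (z == a) ⋆ (j == b) ⋆ g j ∙ ∑[ j < n ] (z == b) ⋆ (j == a) ⋆ g j
      ≈⟨ ∙-cong (∑-⋆ (z == a) (λ j → (j == b) ⋆ g j)) (∑-⋆ (z == b) (λ j → (j == a) ⋆ g j)) ⟩
    (z == a) ⋆ (∑[ j < n ] (j == b) ⋆ g j) ∙ (z == b) ⋆ (∑[ j < n ] (j == a) ⋆ g j)
      ≈⟨ ∙-cong (⋆-cong (z == a) (∑-single b g)) (⋆-cong (z == b) (∑-single a g)) ⟩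
    (z == a) ⋆ g b ∙ (z == b) ⋆ g a ∎
    where
    z≠a∨z≠b : (z == a) ∧ (z == b) ≡ false
    z≠a∨z≠b with z ≟ a
    ... | yes refl = dec-false (z ≟ b) a≢b
    ... | no _     = ≡.refl
    ∧-disjoint : ∀ p q r s → p ∧ r ≡ false → (p ∧ q) ∧ (r ∧ s) ≡ false
    ∧-disjoint false q r     s _ = ≡.refl
    ∧-disjoint true  q false s _ = ∧-zeroʳ q

  ∑∑-isPair : ∀ {n} {a b : Fin n} → a ≢ b → (g : Fin n → Fin n → Carrier) →
              ∑[ i < n ] ∑[ j < n ] isPair a b i j ⋆ g i j ≈ g a b ∙ g b a
  ∑∑-isPair {n} {a} {b} a≢b g = begin
    ∑[ i < n ] ∑[ j < n ] isPair a b i j ⋆ g i j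
      ≈⟨ sum-cong-≋ (λ i → ∑-isPair a≢b i (g i)) ⟩
    ∑[ i < n ] ((i == a) ⋆ g i b ∙ (i == b) ⋆ g i a)
      ≈⟨ ∑-distrib-+ (λ i → (i == a) ⋆ g i b) (λ i → (i == b) ⋆ g i a) ⟩
    ∑[ i < n ] (i == a) ⋆ g i b ∙ ∑[ i < n ] (i == b) ⋆ g i a
      ≈⟨ ∙-cong (∑-single a (λ i → g i b)) (∑-single b (λ i → g i a)) ⟩
    g a b ∙ g b a ∎

  edgeSum : Graph n → (Fin n → Fin n → Carrier) → Carrier
  edgeSum {n} G g = ∑[ i < n ] ∑[ j < n ] adj G i j ⋆ g i j

  AddsEdge-edgeSum : ∀ {a b} → AddsEdge G a b H → (g : Fin n → Fin n → Carrier) →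
                     edgeSum H g ≈ edgeSum G g ∙ (g a b ∙ g b a)
  AddsEdge-edgeSum {n = n} {G = G} {H = H} {a = a} {b = b} G+ab g = begin
    edgeSum H g
      ≡⟨ sum-cong-≗ (λ i → sum-cong-≗ (λ j → cong (_⋆ g i j) (adj-∨ i j))) ⟩
    ∑[ i < n ] ∑[ j < n ] (adj G i j ∨ isPair a b i j) ⋆ g i j
      ≈⟨ sum-cong-≋ (λ i → ∑-∨ (adj G i) (isPair a b i) (g i) (disjoint i)) ⟩
    ∑[ i < n ] (∑[ j < n ] adj G i j ⋆ g i j ∙ ∑[ j < n ] isPair a b i j ⋆ g i j)
      ≈⟨ ∑-distrib-+ (λ i → ∑[ j < n ] adj G i j ⋆ g i j)
                     (λ i → ∑[ j < n ] isPair a b i j ⋆ g i j) ⟩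
    edgeSum G g ∙ ∑[ i < n ] ∑[ j < n ] isPair a b i j ⋆ g i j
      ≈⟨ ∙-congˡ (∑∑-isPair distinct g) ⟩
    edgeSum G g ∙ (g a b ∙ g b a) ∎
    where open AddsEdge G+ab

  sumList : List Carrier → Carrier
  sumList = Data.List.foldr _∙_ ε

  sumList-++ : ∀ xs ys → sumList (xs ++ ys) ≈ sumList xs ∙ sumList ys
  sumList-++ []       ys = ≈-sym (identityˡ (sumList ys))
  sumList-++ (x ∷ xs) ys = ≈-trans (∙-congˡ (sumList-++ xs ys)) (≈-sym (assoc x _ _))

  sumList-concatMap : ∀ {A B : Set} (h : B → Carrier) (k : A → List B) (xs : List A) →
                      sumList (map h (concatMap k xs)) ≈ sumList (map (sumList ∘ map h ∘ k) xs)
  sumList-concatMap h k []       = ≈-refl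
  sumList-concatMap h k (x ∷ xs) = begin
    sumList (map h (k x ++ concatMap k xs))
      ≡⟨ cong sumList (map-++ h (k x) (concatMap k xs)) ⟩
    sumList (map h (k x) ++ map h (concatMap k xs))
      ≈⟨ sumList-++ (map h (k x)) (map h (concatMap k xs)) ⟩
    sumList (map h (k x)) ∙ sumList (map h (concatMap k xs))
      ≈⟨ ∙-congˡ (sumList-concatMap h k xs) ⟩
    sumList (map h (k x)) ∙ sumList (map (sumList ∘ map h ∘ k) xs) ∎

  sumList-pairs : ∀ {n} (β : Fin n → Fin n → Bool) (h : Fin n × Fin n → Carrier) →
    sumList (map h (concatMap (λ i → concatMap (λ j → if β i j then (i , j) ∷ [] else [])
                                                (allFin n)) (allFin n)))
    ≈ ∑[ i < n ] ∑[ j < n ] β i j ⋆ h (i , j)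
  sumList-pairs {n} β h = ≈-trans (concatMap-∑ (λ i → concatMap (singleton i) (allFin n)))
    (sum-cong-≋ (λ i → ≈-trans (concatMap-∑ (singleton i))
                         (sum-cong-≋ (λ j → sumList-singleton (β i j) (i , j)))))
    where
    singleton : Fin n → Fin n → List (Fin n × Fin n)
    singleton i j = if β i j then (i , j) ∷ [] else []
    concatMap-∑ : ∀ {A} (k : Fin n → List A) {h : A → Carrier} →
                  sumList (map h (concatMap k (allFin n))) ≈ ∑[ i < n ] sumList (map h (k i))
    concatMap-∑ k {h} = ≈-trans (sumList-concatMap h k (allFin n))
                                (≈-reflexive (foldr-map-allFin _∙_ ε (sumList ∘ map h ∘ k)))
    sumList-singleton : ∀ b p → sumList (map h (if b then p ∷ [] else [])) ≈ b ⋆ h p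
    sumList-singleton true  p = identityʳ (h p)
    sumList-singleton false p = ≈-refl

module _ where

  open import Data.Nat using (_+_; _≤_; _<_; z≤n; s≤s; s≤s⁻¹)
  open import Data.Nat.Properties
    using (+-0-commutativeMonoid; +-commutativeSemigroup; +-cancelʳ-≡; +-mono-≤; ≤-trans; ≤-reflexive;
           m≤m+n; m≤n+m; <⇒≱)
  open import Algebra.Properties.CommutativeSemigroup +-commutativeSemigroup
    using () renaming (interchange to +-interchange)
  open FiniteSums +-0-commutativeMonoid
  open ≡-Reasoning

  deg≡∑ : (G : Graph n) (z : Fin n) → deg G z ≡ ∑[ j < n ] adj G z j ⋆ 1
  deg≡∑ G z = foldr-map-allFin _+_ 0 (λ j → adj G z j ⋆ 1)

  AddsEdge-deg : ∀ {a b} → AddsEdge G a b H → (z : Fin n) →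
                 deg H z ≡ deg G z + ((z == a) ⋆ 1 + (z == b) ⋆ 1)
  AddsEdge-deg {n = n} {G = G} {H = H} {a = a} {b = b} G+ab z = begin
    deg H z
      ≡⟨ deg≡∑ H z ⟩
    ∑[ j < n ] adj H z j ⋆ 1
      ≡⟨ sum-cong-≗ (λ j → cong (_⋆ 1) (adj-∨ z j)) ⟩
    ∑[ j < n ] (adj G z j ∨ isPair a b z j) ⋆ 1
      ≡⟨ ∑-∨ (adj G z) (isPair a b z) (λ _ → 1) (disjoint z) ⟩
    ∑[ j < n ] adj G z j ⋆ 1 + ∑[ j < n ] isPair a b z j ⋆ 1
      ≡⟨ cong₂ _+_ (sym (deg≡∑ G z)) (∑-isPair distinct z (λ _ → 1)) ⟩
    deg G z + ((z == a) ⋆ 1 + (z == b) ⋆ 1) ∎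
    where open AddsEdge G+ab

  adj⇒deg-pos : ∀ (G : Graph n) {a b} → adj G a b ≡ true → 0 < deg G a
  adj⇒deg-pos G {a} {b} a~b = subst (0 <_) (sym (AddsEdge-deg (removeEdge-AddsEdge G a~b) a))
    (≤-trans (≤-reflexive (cong (_⋆ 1) (sym (dec-true (a ≟ a) refl))))
             (≤-trans (m≤m+n _ ((a == b) ⋆ 1)) (m≤n+m _ (deg (removeEdge G a b) a))))

  switch-deg : ∀ {G : Graph n} {u v w x} (s : Switchable G u v w x) z → deg (Switch.graph s) z ≡ deg G z
  switch-deg {G = G} {u} {v} {w} {x} s z = +-cancelʳ-≡ (ends u v + ends w x) _ _ (begin
    deg (Switch.graph s) z + (ends u v + ends w x)
      ≡⟨ Switch.balance s +-0-commutativeMonoid (λ H → deg H z) ends (λ H+ab → AddsEdge-deg H+ab z) ⟩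
    deg G z + (ends u w + ends v x)
      ≡⟨ cong (deg G z +_) (+-interchange (ends′ u) (ends′ w) (ends′ v) (ends′ x)) ⟩
    deg G z + (ends u v + ends w x) ∎)
    where
    ends′ : Fin _ → ℕ
    ends′ a = (z == a) ⋆ 1
    ends : Fin _ → Fin _ → ℕ
    ends a b = ends′ a + ends′ b

  ∑-mono-≤ : ∀ {n} {g h : Fin n → ℕ} → (∀ i → g i ≤ h i) → sum g ≤ sum h
  ∑-mono-≤ {zero}  _   = z≤n
  ∑-mono-≤ {suc n} g≤h = +-mono-≤ (g≤h zero) (∑-mono-≤ (g≤h ∘ suc))

  ∑-pos⇒∃ : ∀ {n} (β : Fin n → Bool) → 0 < ∑[ z < n ] β z ⋆ 1 → ∃[ z ] β z ≡ true
  ∑-pos⇒∃ {suc n} β pos with β zero in β₀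
  ... | true  = zero , β₀
  ... | false = Product.map suc id (∑-pos⇒∃ (β ∘ suc) pos)

  -- Since u ∈ N(v) ∖ N(w), the set N(w) ∖ N(v) has at least d(w) − d(v) + 1 ≥ 2 elements.
  private-neighbour : ∀ (G : Graph n) {u v w} → adj G u v ≡ true → adj G u w ≡ false →
                      deg G v < deg G w → ∀ y → ∃[ x ] adj G w x ≡ true × adj G v x ≡ false × x ≢ y
  private-neighbour {n} G {u} {v} {w} u~v u≁w dv<dw y =
    let x , Cx = ∑-pos⇒∃ C (positive _ counted) in x , witness Cx
    where
    C : Fin n → Bool
    C z = adj G w z ∧ not (adj G v z ∨ z == y)
    indicator-bound : ∀ e a b c → (e ≡ true → a ≡ false) → (e ≡ true → b ≡ true) →
                      e ⋆ 1 + a ⋆ 1 ≤ (a ∧ not (b ∨ c)) ⋆ 1 + (c ⋆ 1 + b ⋆ 1)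
    indicator-bound true  a b c a≡false b≡true rewrite a≡false refl | b≡true refl = m≤n+m 1 _
    indicator-bound false true  true  c     _ _ = m≤n+m 1 _
    indicator-bound false true  false true  _ _ = s≤s z≤n
    indicator-bound false true  false false _ _ = s≤s z≤n
    indicator-bound false false b     c     _ _ = z≤n
    pointwise : ∀ z → (z == u) ⋆ 1 + adj G w z ⋆ 1 ≤ C z ⋆ 1 + ((z == y) ⋆ 1 + adj G v z ⋆ 1)
    pointwise z = indicator-bound (z == u) (adj G w z) (adj G v z) (z == y)
      (λ z≡u → trans (cong (adj G w) (==⇒≡ z≡u)) (trans (adj-sym G w u) u≁w))
      (λ z≡u → trans (cong (adj G v) (==⇒≡ z≡u)) (trans (adj-sym G v u) u~v))
    counted : suc (deg G w) ≤ ∑[ z < n ] C z ⋆ 1 + suc (deg G v)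
    counted = subst₂ _≤_
      (trans (∑-distrib-+ (λ z → (z == u) ⋆ 1) (λ z → adj G w z ⋆ 1))
             (cong₂ _+_ (∑-single u (λ _ → 1)) (sym (deg≡∑ G w))))
      (trans (∑-distrib-+ (λ z → C z ⋆ 1) (λ z → (z == y) ⋆ 1 + adj G v z ⋆ 1))
             (cong (∑[ z < n ] C z ⋆ 1 +_)
                   (trans (∑-distrib-+ (λ z → (z == y) ⋆ 1) (λ z → adj G v z ⋆ 1))
                          (cong₂ _+_ (∑-single y (λ _ → 1)) (sym (deg≡∑ G v))))))
      (∑-mono-≤ pointwise)
    positive : ∀ k → suc (deg G w) ≤ k + suc (deg G v) → 0 < k
    positive zero    le = contradiction (s≤s⁻¹ le) (<⇒≱ dv<dw)
    positive (suc k) _  = s≤s z≤n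
    witness : ∀ {x} → C x ≡ true → adj G w x ≡ true × adj G v x ≡ false × x ≢ y
    witness {x} Cx with adj G w x | adj G v x | x ≟ y
    ... | true  | false | no x≢y = refl , refl , x≢y
    ... | true  | false | yes _  = contradiction Cx λ ()
    ... | true  | true  | _      = contradiction Cx λ ()
    ... | false | _     | _      = contradiction Cx λ ()

module _ (R : OrderedAbGroup) where

  open OrderedAbGroup R
  open import Data.Nat using (_<ᵇ_)
  open import Data.Nat.Properties using (<-cmp; _<?_)
  open import Relation.Binary using (tri<; tri≈; tri>)

  +-abelianGroup : AbelianGroup 0ℓ 0ℓ
  +-abelianGroup = record
    { Carrier        = Carrier
    ; _≈_            = _≡_
    ; _∙_            = _+_
    ; ε              = 0#
    ; _⁻¹            = -_
    ; isAbelianGroup = record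
      { isGroup = record
        { isMonoid = record
          { isSemigroup = record
            { isMagma = record { isEquivalence = ≡.isEquivalence ; ∙-cong = cong₂ _+_ }
            ; assoc   = +-assoc }
          ; identity = +-identityˡ , λ x → trans (+-comm x 0#) (+-identityˡ x) }
        ; inverse = +-inverseˡ , λ x → trans (+-comm x (- x)) (+-inverseˡ x)
        ; ⁻¹-cong = cong -_ }
      ; comm = +-comm } }

  open AbelianGroup +-abelianGroup using (commutativeMonoid; group) renaming (identityʳ to +-identityʳ)
  open import Algebra.Properties.Group group using (∙-cancelˡ; //-rightDividesʳ)
  open FiniteSums commutativeMonoid

  <⇒≱ : ∀ {x y} → x < y → ¬ (y ≤ x)
  <⇒≱ (x≤y , x≢y) y≤x = x≢y (≤-antisym x≤y y≤x)

  +-cancelʳ-≤ : ∀ {x y} z → x + z ≤ y + z → x ≤ y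
  +-cancelʳ-≤ {x} {y} z x+z≤y+z =
    subst₂ _≤_ (//-rightDividesʳ z x) (//-rightDividesʳ z y) (+-monoˡ-≤ (- z) x+z≤y+z)

  +-cancel-< : ∀ {a b p q} → a + p ≡ b + q → p < q → b < a
  +-cancel-< {a} {b} {p} {q} a+p≡b+q (p≤q , p≢q) = b≤a , b≢a
    where
    b≤a : b ≤ a
    b≤a = +-cancelʳ-≤ p (subst (b + p ≤_) (sym a+p≡b+q)
                            (subst₂ _≤_ (+-comm p b) (+-comm q b) (+-monoˡ-≤ b p≤q)))
    b≢a : b ≢ a
    b≢a refl = p≢q (∙-cancelˡ b p q a+p≡b+q)

  _<ᶠ_ : Fin n → Fin n → Bool
  i <ᶠ j = toℕ i <ᵇ toℕ j

  Mf≡edgeSum : (f : ℕ → ℕ → Carrier) (G : Graph n) →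
               Mf R f G ≡ edgeSum G (λ i j → (i <ᶠ j) ⋆ f (deg G i) (deg G j))
  Mf≡edgeSum f G = trans (sumList-pairs (λ i j → (i <ᶠ j) ∧ adj G i j) _)
    (sum-cong-≗ λ i → sum-cong-≗ λ j →
      trans (cong (_⋆ f (deg G i) (deg G j)) (∧-comm (i <ᶠ j) (adj G i j)))
            (⋆-∧ (adj G i j) (i <ᶠ j) (f (deg G i) (deg G j))))

  ordered-pair : (F : Fin n → Fin n → Carrier) → (∀ i j → F i j ≡ F j i) → ∀ {a b} → a ≢ b →
                 (a <ᶠ b) ⋆ F a b + (b <ᶠ a) ⋆ F b a ≡ F a b
  ordered-pair F F-sym {a} {b} a≢b with <-cmp (toℕ a) (toℕ b)
  ... | tri< a<b _ b≮a
    rewrite dec-true (toℕ a <? toℕ b) a<b | dec-false (toℕ b <? toℕ a) b≮a = +-identityʳ (F a b)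
  ... | tri≈ _ a≡b _ = contradiction (toℕ-injective a≡b) a≢b
  ... | tri> a≮b _ b<a
    rewrite dec-false (toℕ a <? toℕ b) a≮b | dec-true (toℕ b <? toℕ a) b<a =
    trans (+-identityˡ (F b a)) (F-sym b a)

  Mf-switch : (f : ℕ → ℕ → Carrier) → Symmetric R f →
              ∀ {G : Graph n} {u v w x} (s : Switchable G u v w x) →
              Mf R f (Switch.graph s) + (f (deg G u) (deg G v) + f (deg G w) (deg G x))
                ≡ Mf R f G + (f (deg G u) (deg G w) + f (deg G v) (deg G x))
  Mf-switch f f-sym {G = G} {u} {v} {w} {x} s = begin
    Mf R f S + (F u v + F w x)
      ≡⟨ cong₂ _+_ Mf-S (cong₂ _+_ (F≡δ (Switch.u≢v s)) (F≡δ (adj⇒≢ G w~x))) ⟩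
    edgeSum S ω + (δ u v + δ w x)
      ≡⟨ Switch.balance s commutativeMonoid (λ H → edgeSum H ω) δ
                        (λ H+ab → AddsEdge-edgeSum H+ab ω) ⟩
    edgeSum G ω + (δ u w + δ v x)
      ≡⟨ cong₂ _+_ (Mf≡edgeSum f G) (cong₂ _+_ (F≡δ u≢w) (F≡δ v≢x)) ⟨
    Mf R f G + (F u w + F v x) ∎
    where
    open ≡-Reasoning
    open Switchable s
    S : Graph _
    S = Switch.graph s
    F : Fin _ → Fin _ → Carrier
    F a b = f (deg G a) (deg G b)
    ω : Fin _ → Fin _ → Carrier
    ω i j = (i <ᶠ j) ⋆ F i j
    δ : Fin _ → Fin _ → Carrier
    δ a b = ω a b + ω b a
    F≡δ : ∀ {a b} → a ≢ b → F a b ≡ δ a b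
    F≡δ = sym ∘ ordered-pair F (λ i j → f-sym (deg G i) (deg G j))
    Mf-S : Mf R f S ≡ edgeSum S ω
    Mf-S = trans (Mf≡edgeSum f S) (sum-cong-≗ λ i → sum-cong-≗ λ j →
      cong (λ d → adj S i j ⋆ (i <ᶠ j) ⋆ d) (cong₂ f (switch-deg s i) (switch-deg s j)))

  switch-raises : (f : ℕ → ℕ → Carrier) → Symmetric R f →
                  ∀ {G : Graph n} {u v w x} (s : Switchable G u v w x) →
                  f (deg G w) (deg G x) + f (deg G u) (deg G v)
                    < f (deg G u) (deg G w) + f (deg G x) (deg G v) →
                  Mf R f G < Mf R f (Switch.graph s)
  switch-raises f f-sym {G = G} {u} {v} {w} {x} s gain = +-cancel-< (Mf-switch f f-sym s)
    (subst₂ _<_ (+-comm _ _) (cong (f (deg G u) (deg G w) +_) (f-sym (deg G x) (deg G v))) gain)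

  switch-lowers : (f : ℕ → ℕ → Carrier) → Symmetric R f →
                  ∀ {G : Graph n} {u v w x} (s : Switchable G u v w x) →
                  f (deg G u) (deg G w) + f (deg G x) (deg G v)
                    < f (deg G w) (deg G x) + f (deg G u) (deg G v) →
                  Mf R f (Switch.graph s) < Mf R f G
  switch-lowers f f-sym {G = G} {u} {v} {w} {x} s loss = +-cancel-< (sym (Mf-switch f f-sym s))
    (subst₂ _<_ (cong (f (deg G u) (deg G w) +_) (f-sym (deg G x) (deg G v))) (+-comm _ _) loss)

open import Data.Nat using (_<_; _≤_)
open import Data.Nat.Properties using (<-irrefl)

SwitchPartner : Graph n → Fin n → Fin n → Fin n → Set
SwitchPartner G u v w = ∃[ x ] Σ[ s ∈ Switchable G u v w x ] Reach (Switch.graph s) u v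

module _ {G : Graph n} {u v w : Fin n} (u~v : adj G u v ≡ true) (u≁w : adj G u w ≡ false) (u≢w : u ≢ w)
         (dv<dw : deg G v < deg G w) where

  private
    K : Graph n
    K = removeEdge G u v

    v≢w : v ≢ w
    v≢w refl = <-irrefl refl dv<dw

    switchable : ∀ {x} → adj G w x ≡ true → adj G v x ≡ false → x ≢ v → Switchable G u v w x
    switchable w~x v≁x x≢v = record
      { u~v = u~v ; w~x = w~x ; u≁w = u≁w ; v≁x = v≁x ; u≢w = u≢w ; v≢w = v≢w ; v≢x = x≢v ∘ sym }

    w≁v⇒≢v : adj G w v ≡ false → ∀ {x} → adj G w x ≡ true → x ≢ v
    w≁v⇒≢v w≁v w~x refl = contradiction (trans (sym w~x) w≁v) λ ()

    ¬IsPair-uv-w : ∀ {y} → ¬ IsPair u v w y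
    ¬IsPair-uv-w (inj₁ (w≡u , _)) = u≢w (sym w≡u)
    ¬IsPair-uv-w (inj₂ (w≡v , _)) = v≢w (sym w≡v)

    partner-w~v : adj G w v ≡ true → SwitchPartner G u v w
    partner-w~v w~v =
      let x , w~x , v≁x , x≢v = private-neighbour G u~v u≁w dv<dw v
          s = switchable w~x v≁x x≢v
      in  x , s , step (Switch.u~w s) (edge (Switch.keeps s w~v ¬IsPair-uv-w λ
            { (inj₁ (_ , v≡x)) → x≢v (sym v≡x)
            ; (inj₂ (_ , v≡w)) → v≢w v≡w }))

    -- u – w – y ⇝ v, where the walk from y to v avoids w and the edge uv
    partner-v⇝w : adj G w v ≡ false → Reach K v w → SwitchPartner G u v w
    partner-v⇝w w≁v v⇝w =
      let y , y~w , v⇝y = first-arrival v⇝w v≢w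
          x , w~x , v≁x , x≢y = private-neighbour G u~v u≁w dv<dw y
          s = switchable w~x v≁x (w≁v⇒≢v w≁v w~x)
          w~y = trans (adj-sym G w y) (removeEdge-⊆ G u v y~w)
      in  x , s , step (Switch.u~w s) (step (Switch.keeps s w~y ¬IsPair-uv-w λ
            { (inj₁ (_ , y≡x)) → x≢y (sym y≡x)
            ; (inj₂ (_ , y≡w)) → adj⇒≢ K y~w y≡w })
          (Reach-sym (Reach-mono (Switch.G₁-w⊆graph s) v⇝y)))

    -- u ⇝ y – v, where the walk from u to y avoids w and the edge uv
    partner-u⇝w : adj G w v ≡ false → Reach K u w → SwitchPartner G u v w
    partner-u⇝w w≁v u⇝w with first-arrival u⇝w u≢w
    ... | y , y~w , u⇝y with adj G v y in v~y?
    ...   | true  = partner-v⇝w w≁v (step (removeEdge-keeps G v~y? λ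
                      { (inj₁ (v≡u , _)) → adj⇒≢ G u~v (sym v≡u)
                      ; (inj₂ (_ , y≡u)) → y≢u y≡u }) (edge y~w))
      where
      y≢u : y ≢ u
      y≢u refl = contradiction (trans (sym (removeEdge-⊆ G u v y~w)) u≁w) λ ()
    ...   | false =
      let w~y = trans (adj-sym G w y) (removeEdge-⊆ G u v y~w)
          s = switchable w~y v~y? (w≁v⇒≢v w≁v w~y)
      in  y , s , Reach-++ (Reach-mono (Switch.G₁-w⊆graph s) u⇝y) (Reach-sym (edge (Switch.v~x s)))

  switch-partner : Connected G → SwitchPartner G u v w
  switch-partner connected with adj G w v in w~v?
  ... | true  = partner-w~v w~v?
  ... | false with removeEdge-reach {b = v} (connected w u)
  ...   | inj₂ w⇝v = partner-v⇝w w~v? (Reach-sym w⇝v)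
  ...   | inj₁ w⇝u = partner-u⇝w w~v? (Reach-sym w⇝u)

switch-InΓ : ∀ {π} {G : Graph n} {u v w x} (s : Switchable G u v w x) → Reach (Switch.graph s) u v →
             InΓ π G → InΓ π (Switch.graph s)
switch-InΓ {n = n} {π} s u⇝v (connected , degrees) =
  Switch.connected s u⇝v connected , subst (_↭ π) (sym (map-cong (switch-deg s) (allFin n))) degrees

lemma2 : (R : OrderedAbGroup) (f : ℕ → ℕ → OrderedAbGroup.Carrier R) →
    Symmetric R f → Escalating R f ⊎ DeEscalating R f →
    (π : List ℕ) → NonIncreasing π →
    {n : ℕ} (G : Graph n) → InΓ π G →
    (u v w : Fin n) → u ≢ w →
    adj G u v ≡ true → adj G u w ≡ false →
    deg G v < deg G w → deg G w ≤ deg G u →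
    (∀ (x : Fin n) → adj G w x ≡ true → deg G x < deg G u) →
    ¬ Extremal R f π G
lemma2 R f f-sym _ π _ G G∈Γ u v w u≢w u~v u≁w dv<dw _ N[w]<du (_ , optimal)
  with switch-partner u~v u≁w u≢w dv<dw (proj₁ G∈Γ)
... | x , s , u⇝v = Sum.[ not-maximal , not-minimal ]′ optimal
  where
  S∈Γ : InΓ π (Switch.graph s)
  S∈Γ = switch-InΓ s u⇝v G∈Γ
  0<dx : 0 < deg G x
  0<dx = adj⇒deg-pos G (trans (adj-sym G x w) (Switchable.w~x s))
  dx<du : deg G x < deg G u
  dx<du = N[w]<du x (Switchable.w~x s)
  0<dv : 0 < deg G v
  0<dv = adj⇒deg-pos G (trans (adj-sym G v u) u~v)
  not-maximal : ¬ (Escalating R f × (∀ H → InΓ π H → OrderedAbGroup._≤_ R (Mf R f H) (Mf R f G)))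
  not-maximal (escalating , maximal) =
    <⇒≱ R (switch-raises R f f-sym s (proj₂ escalating _ _ _ _ 0<dx dx<du 0<dv dv<dw)) (maximal _ S∈Γ)
  not-minimal : ¬ (DeEscalating R f × (∀ H → InΓ π H → OrderedAbGroup._≤_ R (Mf R f G) (Mf R f H)))
  not-minimal (de-escalating , minimal) =
    <⇒≱ R (switch-lowers R f f-sym s (proj₂ de-escalating _ _ _ _ 0<dx dx<du 0<dv dv<dw)) (minimal _ S∈Γ)
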